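{- Let $M$ be a rank-3 inseparable matroid on $S$. Then $M$ has two proper flats $F$ and $L$ with $F\cap L\neq\emptyset$ and $F\cup L=S$ if and only if $M$ has a rank-1 degenerate flat $T$. Moreover, these flats are unique, $F$ and $L$ are rank-2 non-degenerate flats, and $T=F\cap L$.
   Context: A matroid is inseparable (connected) if it has no separator other than $\emptyset$ and the ground set (a separator $A$ satisfies $r(A)+r(S\setminus A)=r(S)$). For an inseparable matroid $M$ on $S$, a subset $A\notin\{\emptyset,S\}$ is non-degenerate if both $M/A$ and $M|_A$ are inseparable; a nonempty proper flat that is not non-degenerate is called degenerate. -}

module Defs where

open import Data.Nat using (ℕ; _≤_; _+_; _∸_)
open import Data.Fin using (Fin)
open import Data.Fin.Subset
  using (Subset; ⊥; ⊤; ⁅_⁆; _∈_; _∉_; _⊆_; _∪_; _∩_; _─_; ∣_∣; Nonempty)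
open import Data.Product using (_×_; Σ)
open import Data.Sum using (_⊎_)
open import Relation.Nullary using (¬_)
open import Relation.Binary.PropositionalEquality using (_≡_; _≢_)

record Matroid (n : ℕ) : Set where
  field
    r        : Subset n → ℕ
    r-bound  : ∀ X → r X ≤ ∣ X ∣
    r-mono   : ∀ {X Y} → X ⊆ Y → r X ≤ r Y
    r-submod : ∀ X Y → r (X ∪ Y) + r (X ∩ Y) ≤ r X + r Y

-- A "matroid" described by a ground set E ⊆ Fin n and a rank function ρ
-- (used only on subsets of E).  A separator of it is a subset A ⊆ E with
-- ρ A + ρ (E ∖ A) = ρ E.
InseparableOn : ∀ {n} → Subset n → (Subset n → ℕ) → Set
InseparableOn E ρ =
  ∀ A → A ⊆ E → ρ A + ρ (E ─ A) ≡ ρ E → (A ≡ ⊥ ⊎ A ≡ E)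

module _ {n : ℕ} (M : Matroid n) where
  open Matroid M

  Inseparable : Set
  Inseparable = InseparableOn ⊤ r

  RestrictionInseparable : Subset n → Set
  RestrictionInseparable A = InseparableOn A r

  ContractionInseparable : Subset n → Set
  ContractionInseparable A = InseparableOn (⊤ ─ A) (λ X → r (X ∪ A) ∸ r A)

  NonDegenerate : Subset n → Set
  NonDegenerate A =
    A ≢ ⊥ × A ≢ ⊤ × ContractionInseparable A × RestrictionInseparable A

  Flat : Subset n → Set
  Flat F = ∀ x → x ∉ F → r (F ∪ ⁅ x ⁆) ≢ r F

  ProperFlat : Subset n → Set
  ProperFlat F = Flat F × F ≢ ⊤

  DegenerateFlat : Subset n → Set
  DegenerateFlat T = Flat T × T ≢ ⊥ × T ≢ ⊤ × ¬ NonDegenerate T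

  CoveringPair : Subset n → Subset n → Set
  CoveringPair F L = ProperFlat F × ProperFlat L × Nonempty (F ∩ L) × F ∪ L ≡ ⊤

  RankOneDegenerateFlat : Subset n → Set
  RankOneDegenerateFlat T = DegenerateFlat T × r T ≡ 1

-- Inseparability makes M loopless and
-- forces r A + r (S ∖ A) > r S for every nonempty proper A.  For a covering
-- pair F, L (proper flats, F ∩ L ≠ ∅, F ∪ L = S) submodularity gives
-- r F = r L = 2 and r (F ∩ L) = 1, and the strict inequality for A = L gives
-- r (S ∖ L) = 2.  Since a set of rank ≤ 1 meeting a flat lies inside it,
-- F cannot be covered by two sets of rank ≤ 1 one of which meets L.  This one
-- fact shows both that M|F is inseparable (so F is non-degenerate, M/F being
-- inseparable because it has rank 1) and that any other covering pair must
-- contain F (uniqueness).  The set S ∖ L separates M/(F ∩ L), so F ∩ L is a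
-- rank-one degenerate flat.  Conversely a proper separator A of M/T, for a
-- rank-one degenerate flat T, yields the covering pair A ∪ T, (S ∖ T ∖ A) ∪ T
-- with meet T.  Uniqueness of the pair then gives T = F ∩ L and uniqueness of T.
module Submission where

open import Defs
open import Data.Nat using (ℕ; suc; _+_; _∸_; _≤_; _<_; s≤s; z≤n; _≤?_; _≟_)
open import Data.Nat.Properties
  using (≤-refl; ≤-trans; ≤-antisym; ≤-reflexive; ≤-pred; ≰⇒>; ≤∧≢⇒<; n≮n; n≤0⇒n≡0;
         +-mono-≤; +-monoʳ-≤; +-cancelˡ-≤; +-cancelʳ-≤; +-comm; m≤m+n; m+n∸n≡m;
         ∸-monoˡ-≤; m<n⇒0<n∸m; module ≤-Reasoning)
open import Data.Fin using (Fin)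
open import Data.Fin.Subset
open import Data.Fin.Subset.Properties
  using (_∈?_; _⊆?_; nonempty?; anySubset?; Empty-unique; ∉⊥; ∈⊤; ⊆⊤; x∈⁅x⁆;
         x∈⁅y⁆⇒x≡y; ⊆-antisym; x∈p∩q⁺; x∈p∩q⁻; x∈p∪q⁺; x∈p∪q⁻;
         x∈p∧x∉q⇒x∈p─q; p─q⊆p; ∪-comm; ∩-comm)
open import Data.Vec using (_∷_; here; there)
open import Data.Vec.Properties using (≡-dec)
import Data.Bool as Bool
open import Data.Product using (∃; ∃₂; _×_; _,_; proj₁; proj₂)
open import Data.Sum using (_⊎_; inj₁; inj₂; [_,_]′) renaming (swap to ⊎-swap)
open import Data.Empty using (⊥-elim)
open import Relation.Nullary using (¬_; Dec; yes; no)
open import Relation.Nullary.Decidable using (_×-dec_)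
open import Relation.Binary.PropositionalEquality
  using (_≡_; _≢_; sym; trans; cong; cong₂; subst)

∉-─ʳ : ∀ {n} (p q : Subset n) {x} → x ∈ p ─ q → x ∉ q
∉-─ʳ (inside ∷ p) (outside ∷ q) here ()
∉-─ʳ (s ∷ p) (t ∷ q) (there x∈p─q) (there x∈q) = ∉-─ʳ p q x∈p─q x∈q

module _ {n : ℕ} where

  _≟ₛ_ : (p q : Subset n) → Dec (p ≡ q)
  _≟ₛ_ = ≡-dec Bool._≟_

  ∈-∪ˡ : ∀ {p q : Subset n} {x} → x ∈ p → x ∈ p ∪ q
  ∈-∪ˡ x∈p = x∈p∪q⁺ (inj₁ x∈p)

  ∈-∪ʳ : ∀ {p q : Subset n} {x} → x ∈ q → x ∈ p ∪ q
  ∈-∪ʳ x∈q = x∈p∪q⁺ (inj₂ x∈q)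

  ∪-least : ∀ {p q s : Subset n} → p ⊆ s → q ⊆ s → p ∪ q ⊆ s
  ∪-least {p} {q} p⊆s q⊆s x∈p∪q = [ p⊆s , q⊆s ]′ (x∈p∪q⁻ p q x∈p∪q)

  ∈-∩ : ∀ {p q : Subset n} {x} → x ∈ p → x ∈ q → x ∈ p ∩ q
  ∈-∩ x∈p x∈q = x∈p∩q⁺ (x∈p , x∈q)

  ∈-∩ˡ : ∀ {p q : Subset n} {x} → x ∈ p ∩ q → x ∈ p
  ∈-∩ˡ {p} {q} x∈p∩q = proj₁ (x∈p∩q⁻ p q x∈p∩q)

  ∈-∩ʳ : ∀ {p q : Subset n} {x} → x ∈ p ∩ q → x ∈ q
  ∈-∩ʳ {p} {q} x∈p∩q = proj₂ (x∈p∩q⁻ p q x∈p∩q)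

  ∈-─ : ∀ {p q : Subset n} {x} → x ∈ p → x ∉ q → x ∈ p ─ q
  ∈-─ = x∈p∧x∉q⇒x∈p─q

  ∈-─ˡ : ∀ {p q : Subset n} {x} → x ∈ p ─ q → x ∈ p
  ∈-─ˡ {p} {q} = p─q⊆p p q

  ∉-─ : ∀ {p q : Subset n} {x} → x ∈ p ─ q → x ∉ q
  ∉-─ {p} {q} = ∉-─ʳ p q

  ∈-compl : ∀ {q : Subset n} {x} → x ∉ q → x ∈ ⊤ ─ q
  ∈-compl = ∈-─ ∈⊤

  ∈-or-∉ : ∀ (q : Subset n) x → x ∈ q ⊎ x ∉ q
  ∈-or-∉ q x with x ∈? q
  ... | yes x∈q = inj₁ x∈q
  ... | no x∉q = inj₂ x∉q

  ∉-compl⇒∈ : ∀ {q : Subset n} {x} → x ∉ ⊤ ─ q → x ∈ q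
  ∉-compl⇒∈ {q} {x} x∉∁q = [ (λ x∈q → x∈q) , (λ x∉q → ⊥-elim (x∉∁q (∈-compl x∉q))) ]′ (∈-or-∉ q x)

  covered : ∀ {p q : Subset n} → (∀ {x} → x ∉ p → x ∈ q) → ∀ x → x ∈ p ⊎ x ∈ q
  covered {p} out x = [ inj₁ , (λ x∉p → inj₂ (out x∉p)) ]′ (∈-or-∉ p x)

  split : ∀ (p q : Subset n) {x} → x ∈ p → x ∈ q ⊎ x ∈ p ─ q
  split p q {x} x∈p = [ inj₁ , (λ x∉q → inj₂ (∈-─ x∈p x∉q)) ]′ (∈-or-∉ q x)

  ⁅⁆⊆ : ∀ {p : Subset n} {x} → x ∈ p → ⁅ x ⁆ ⊆ p
  ⁅⁆⊆ {p} {x} x∈p y∈⁅x⁆ = subst (_∈ p) (sym (x∈⁅y⁆⇒x≡y x y∈⁅x⁆)) x∈p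

  ∈⇒≢⊥ : ∀ {p : Subset n} {x} → x ∈ p → p ≢ ⊥
  ∈⇒≢⊥ {x = x} x∈p p≡⊥ = ∉⊥ (subst (x ∈_) p≡⊥ x∈p)

  ∉⇒≢⊤ : ∀ {p : Subset n} {x} → x ∉ p → p ≢ ⊤
  ∉⇒≢⊤ {x = x} x∉p p≡⊤ = x∉p (subst (x ∈_) (sym p≡⊤) ∈⊤)

  ≢⊥⇒nonempty : ∀ {p : Subset n} → p ≢ ⊥ → Nonempty p
  ≢⊥⇒nonempty {p} p≢⊥ with nonempty? p
  ... | yes ne = ne
  ... | no empty = ⊥-elim (p≢⊥ (Empty-unique empty))

  proper⇒gap : ∀ {p q : Subset n} → q ⊆ p → q ≢ p → Nonempty (p ─ q)
  proper⇒gap {p} {q} q⊆p q≢p with nonempty? (p ─ q)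
  ... | yes gap = gap
  ... | no no-gap = ⊥-elim (q≢p (⊆-antisym q⊆p p⊆q))
    where
    p⊆q : p ⊆ q
    p⊆q {x} x∈p = [ (λ x∈q → x∈q) , (λ x∈p─q → ⊥-elim (no-gap (x , x∈p─q))) ]′ (split p q x∈p)

  ≢⊤⇒outside : ∀ {p : Subset n} → p ≢ ⊤ → ∃ λ x → x ∉ p
  ≢⊤⇒outside {p} p≢⊤ =
    let (x , x∈⊤─p) = proper⇒gap ⊆⊤ p≢⊤ in x , ∉-─ x∈⊤─p

sum≤2⇒≤1 : ∀ {a b} → a + b ≤ 2 → 1 ≤ b → a ≤ 1
sum≤2⇒≤1 {a} a+b≤2 1≤b = +-cancelʳ-≤ 1 a 1 (≤-trans (+-monoʳ-≤ a 1≤b) a+b≤2)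

covering-ranks : ∀ {a b c} → a ≤ 2 → b ≤ 2 → 1 ≤ c → 3 + c ≤ a + b →
                 a ≡ 2 × b ≡ 2 × c ≡ 1
covering-ranks {a} {b} {c} a≤2 b≤2 1≤c 3+c≤a+b =
  ≤-antisym a≤2 (+-cancelʳ-≤ 2 2 a (≤-trans 4≤a+b (+-monoʳ-≤ a b≤2))) ,
  ≤-antisym b≤2 (+-cancelˡ-≤ 2 2 b (≤-trans 4≤a+b (+-mono-≤ a≤2 ≤-refl))) ,
  ≤-antisym (+-cancelˡ-≤ 3 c 1 (≤-trans 3+c≤a+b (+-mono-≤ a≤2 b≤2))) 1≤c
  where
  4≤a+b : 4 ≤ a + b
  4≤a+b = ≤-trans (+-monoʳ-≤ 3 1≤c) 3+c≤a+b

excesses : ∀ {x y} → 2 ≤ x → 2 ≤ y → (x ∸ 1) + (y ∸ 1) ≤ 2 → x ≡ 2 × y ≡ 2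
excesses {suc x} {suc y} (s≤s 1≤x) (s≤s 1≤y) sum≤2 =
  cong suc (≤-antisym (sum≤2⇒≤1 sum≤2 1≤y) 1≤x) ,
  cong suc (≤-antisym (sum≤2⇒≤1 (subst (_≤ 2) (+-comm x y) sum≤2) 1≤x) 1≤y)

module _ {n : ℕ} {E : Subset n} {ρ : Subset n → ℕ} where

  ProperSeparator : Subset n → Set
  ProperSeparator A = A ⊆ E × ρ A + ρ (E ─ A) ≡ ρ E × Nonempty A × Nonempty (E ─ A)

  no-proper-separator⇒inseparable : (∀ A → ¬ ProperSeparator A) → InseparableOn E ρ
  no-proper-separator⇒inseparable none A A⊆E sep with A ≟ₛ ⊥ | A ≟ₛ E
  ... | yes A≡⊥ | _ = inj₁ A≡⊥
  ... | no _ | yes A≡E = inj₂ A≡E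
  ... | no A≢⊥ | no A≢E = ⊥-elim (none A (A⊆E , sep , ≢⊥⇒nonempty A≢⊥ , proper⇒gap A⊆E A≢E))

  -- Classically, a separable ground set has a proper separator; here by
  -- exhaustive search over the finitely many subsets.
  separable⇒proper-separator : ¬ InseparableOn E ρ → ∃ ProperSeparator
  separable⇒proper-separator separable with anySubset? decide
    where
    decide : ∀ A → Dec (ProperSeparator A)
    decide A = (A ⊆? E) ×-dec ((ρ A + ρ (E ─ A) ≟ ρ E) ×-dec (nonempty? A ×-dec nonempty? (E ─ A)))
  ... | yes found = found
  ... | no none = ⊥-elim (separable (no-proper-separator⇒inseparable (λ A p → none (A , p))))

  -- A ground set of rank ≤ 1 on which nonempty sets have positive rank is
  -- inseparable: a proper separator would give it rank ≥ 2.
  rank-one-inseparable : (∀ {X x} → X ⊆ E → x ∈ X → 1 ≤ ρ X) → ρ E ≤ 1 → InseparableOn E ρ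
  rank-one-inseparable positive ρE≤1 = no-proper-separator⇒inseparable separator-absurd
    where
    separator-absurd : ∀ A → ¬ ProperSeparator A
    separator-absurd A (A⊆E , sep , (a , a∈A) , (b , b∈E─A)) =
      n≮n 1 (≤-trans (+-mono-≤ (positive A⊆E a∈A) (positive ∈-─ˡ b∈E─A))
                     (≤-trans (≤-reflexive sep) ρE≤1))

module FlatFacts {n : ℕ} (M : Matroid n) where
  open Matroid M

  flat-absorbs : ∀ {F Y} → Flat M F → F ⊆ Y → r Y ≤ r F → Y ⊆ F
  flat-absorbs {F} {Y} flatF F⊆Y rY≤rF {y} y∈Y with y ∈? F
  ... | yes y∈F = y∈F
  ... | no y∉F = ⊥-elim (flatF y y∉F (≤-antisym (≤-trans (r-mono (∪-least F⊆Y (⁅⁆⊆ y∈Y))) rY≤rF)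
                                                 (r-mono ∈-∪ˡ)))

  flat-extends : ∀ {F Y x} → Flat M F → x ∉ F → F ∪ ⁅ x ⁆ ⊆ Y → r F < r Y
  flat-extends {x = x} flatF x∉F F+x⊆Y =
    ≤-trans (≤∧≢⇒< (r-mono ∈-∪ˡ) (λ same → flatF x x∉F (sym same))) (r-mono F+x⊆Y)

  -- A point outside a flat F also raises the rank of every Z ⊆ F
  -- (submodularity of F and Z + x).
  flat-extends-subset : ∀ {F Z x} → Flat M F → x ∉ F → Z ⊆ F → r (Z ∪ ⁅ x ⁆) ≢ r Z
  flat-extends-subset {F} {Z} {x} flatF x∉F Z⊆F same =
    n≮n (r F) (+-cancelʳ-≤ (r Z) _ _ (begin
      suc (r F) + r Z                       ≤⟨ +-mono-≤ (flat-extends flatF x∉F F+x⊆) Z⊆meet ⟩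
      r (F ∪ (Z ∪ ⁅ x ⁆)) + r (F ∩ (Z ∪ ⁅ x ⁆)) ≤⟨ r-submod F (Z ∪ ⁅ x ⁆) ⟩
      r F + r (Z ∪ ⁅ x ⁆)                   ≡⟨ cong (r F +_) same ⟩
      r F + r Z                             ∎))
    where
    open ≤-Reasoning
    F+x⊆ : F ∪ ⁅ x ⁆ ⊆ F ∪ (Z ∪ ⁅ x ⁆)
    F+x⊆ = ∪-least ∈-∪ˡ (λ y∈⁅x⁆ → ∈-∪ʳ (∈-∪ʳ y∈⁅x⁆))
    Z⊆meet : r Z ≤ r (F ∩ (Z ∪ ⁅ x ⁆))
    Z⊆meet = r-mono (λ z∈Z → ∈-∩ (Z⊆F z∈Z) (∈-∪ˡ z∈Z))

  flat-∩ : ∀ {F G} → Flat M F → Flat M G → Flat M (F ∩ G)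
  flat-∩ {F} {G} flatF flatG x x∉F∩G with x ∈? F | x ∈? G
  ... | no x∉F | _ = flat-extends-subset flatF x∉F ∈-∩ˡ
  ... | yes _ | no x∉G = flat-extends-subset flatG x∉G ∈-∩ʳ
  ... | yes x∈F | yes x∈G = ⊥-elim (x∉F∩G (∈-∩ x∈F x∈G))

  proper-flat-rank : ∀ {F} → Flat M F → F ≢ ⊤ → r F < r ⊤
  proper-flat-rank {F} flatF F≢⊤ with suc (r F) ≤? r ⊤
  ... | yes lt = lt
  ... | no ¬lt = ⊥-elim (F≢⊤ (⊆-antisym ⊆⊤ (flat-absorbs flatF ⊆⊤ (≤-pred (≰⇒> ¬lt)))))

  distinct-flats-meet : ∀ {F G} → Flat M F → Flat M G → r F ≡ r G → F ≢ G → r (F ∩ G) < r F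
  distinct-flats-meet {F} {G} flatF flatG rF≡rG F≢G with suc (r (F ∩ G)) ≤? r F
  ... | yes lt = lt
  ... | no ¬lt = ⊥-elim (F≢G (⊆-antisym (λ x∈F → ∈-∩ʳ (F⊆F∩G x∈F)) (λ x∈G → ∈-∩ˡ (G⊆F∩G x∈G))))
    where
    rF≤meet : r F ≤ r (F ∩ G)
    rF≤meet = ≤-pred (≰⇒> ¬lt)
    F⊆F∩G : F ⊆ F ∩ G
    F⊆F∩G = flat-absorbs (flat-∩ flatF flatG) ∈-∩ˡ rF≤meet
    G⊆F∩G : G ⊆ F ∩ G
    G⊆F∩G = flat-absorbs (flat-∩ flatF flatG) ∈-∩ʳ (subst (_≤ r (F ∩ G)) rF≡rG rF≤meet)

  -- The contraction by a flat of corank ≤ 1 is inseparable: it has rank ≤ 1,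
  -- and every nonempty set outside the flat has positive contracted rank.
  flat-contraction-inseparable : ∀ {F} → Flat M F → r ⊤ ≤ suc (r F) → ContractionInseparable M F
  flat-contraction-inseparable {F} flatF corank≤1 = rank-one-inseparable positive top≤1
    where
    positive : ∀ {X x} → X ⊆ ⊤ ─ F → x ∈ X → 1 ≤ r (X ∪ F) ∸ r F
    positive X⊆∁F x∈X =
      m<n⇒0<n∸m (flat-extends flatF (∉-─ (X⊆∁F x∈X)) (∪-least ∈-∪ʳ (λ y → ∈-∪ˡ (⁅⁆⊆ x∈X y))))
    top≤1 : r ((⊤ ─ F) ∪ F) ∸ r F ≤ 1
    top≤1 = ≤-trans (∸-monoˡ-≤ (r F) (≤-trans (r-mono ⊆⊤) corank≤1)) (≤-reflexive (m+n∸n≡m 1 (r F)))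

  -- Two sets covering the ground set whose meet contains a flat T, with
  -- r F + r L ≤ r S + r T, consist of flats: a point x outside F lies in
  -- L ∖ T, so F + x and L would violate submodularity.
  modular-cover-flat : ∀ {F L T} → Flat M T → T ⊆ F → T ⊆ L → (∀ {x} → x ∉ F → x ∈ L) →
                       r F + r L ≤ r ⊤ + r T → Flat M F
  modular-cover-flat {F} {L} {T} flatT T⊆F T⊆L outside-in-L modular x x∉F same =
    n≮n (r T) (+-cancelˡ-≤ (r ⊤) _ _ (begin
      r ⊤ + suc (r T)                          ≤⟨ +-mono-≤ spans raises ⟩
      r ((F ∪ ⁅ x ⁆) ∪ L) + r ((F ∪ ⁅ x ⁆) ∩ L) ≤⟨ r-submod (F ∪ ⁅ x ⁆) L ⟩
      r (F ∪ ⁅ x ⁆) + r L                      ≡⟨ cong (_+ r L) same ⟩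
      r F + r L                                ≤⟨ modular ⟩
      r ⊤ + r T                                ∎))
    where
    open ≤-Reasoning
    spans : r ⊤ ≤ r ((F ∪ ⁅ x ⁆) ∪ L)
    spans = r-mono (λ {y} _ → [ (λ y∈F → ∈-∪ˡ (∈-∪ˡ y∈F)) , ∈-∪ʳ ]′ (covered outside-in-L y))
    x∈meet : ⁅ x ⁆ ⊆ (F ∪ ⁅ x ⁆) ∩ L
    x∈meet = ⁅⁆⊆ (∈-∩ (∈-∪ʳ (x∈⁅x⁆ x)) (outside-in-L x∉F))
    raises : r T < r ((F ∪ ⁅ x ⁆) ∩ L)
    raises = flat-extends flatT (λ x∈T → x∉F (T⊆F x∈T))
               (∪-least (λ y∈T → ∈-∩ (∈-∪ˡ (T⊆F y∈T)) (T⊆L y∈T)) x∈meet)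

module LooplessFacts {n : ℕ} (M : Matroid n) (loopless : ∀ x → 1 ≤ Matroid.r M ⁅ x ⁆) where
  open Matroid M
  open FlatFacts M

  nonempty-rank : ∀ {X x} → x ∈ X → 1 ≤ r X
  nonempty-rank {x = x} x∈X = ≤-trans (loopless x) (r-mono (⁅⁆⊆ x∈X))

  small-set-in-flat : ∀ {G X x} → Flat M G → r X ≤ 1 → x ∈ X → x ∈ G → X ⊆ G
  small-set-in-flat {G} {X} flatG rX≤1 x∈X x∈G x'∈X =
    flat-absorbs flatG ∈-∪ʳ union≤G (∈-∪ˡ x'∈X)
    where
    union≤G : r (X ∪ G) ≤ r G
    union≤G = +-cancelʳ-≤ 1 _ _ (≤-trans (+-monoʳ-≤ (r (X ∪ G)) (nonempty-rank (∈-∩ x∈X x∈G)))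
                (≤-trans (r-submod X G) (subst (r X + r G ≤_) (+-comm 1 (r G)) (+-mono-≤ rX≤1 ≤-refl))))

module InseparableFacts {n : ℕ} (M : Matroid n) (inseparable : Inseparable M) where
  open Matroid M

  complement-rank : ∀ A → r ⊤ ≤ r A + r (⊤ ─ A)
  complement-rank A = ≤-trans (r-mono (λ {x} _ → [ ∈-∪ˡ , (λ x∉A → ∈-∪ʳ (∈-compl x∉A)) ]′ (∈-or-∉ A x)))
                     (≤-trans (m≤m+n _ _) (r-submod A (⊤ ─ A)))

  proper-subset-rank : ∀ {A} → A ≢ ⊥ → A ≢ ⊤ → r ⊤ < r A + r (⊤ ─ A)
  proper-subset-rank {A} A≢⊥ A≢⊤ =
    ≤∧≢⇒< (complement-rank A) (λ sep → [ A≢⊥ , A≢⊤ ]′ (inseparable A ⊆⊤ (sym sep)))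

  loopless : 1 ≤ r ⊤ → ∀ x → 1 ≤ r ⁅ x ⁆
  loopless 1≤r⊤ x with 1 ≤? r ⁅ x ⁆
  ... | yes positive = positive
  ... | no ¬positive = ⊥-elim (n≮n (r ⊤) (≤-trans (proper-subset-rank (∈⇒≢⊥ (x∈⁅x⁆ x)) x≢⊤)
                                                  (subst (λ k → k + r (⊤ ─ ⁅ x ⁆) ≤ r ⊤) (sym loop) (r-mono ⊆⊤))))
    where
    loop : r ⁅ x ⁆ ≡ 0
    loop = n≤0⇒n≡0 (≤-pred (≰⇒> ¬positive))
    x≢⊤ : ⁅ x ⁆ ≢ ⊤
    x≢⊤ x≡⊤ = n≮n 0 (subst (1 ≤_) (trans (cong r (sym x≡⊤)) loop) 1≤r⊤)

module Rank3 {n : ℕ} (M : Matroid n) (inseparable : Inseparable M) (r3 : Matroid.r M ⊤ ≡ 3) where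
  open Matroid M
  open FlatFacts M
  open InseparableFacts M inseparable
  open LooplessFacts M (loopless (subst (1 ≤_) (sym r3) (s≤s z≤n)))

  rank≤3 : ∀ X → r X ≤ 3
  rank≤3 X = subst (r X ≤_) r3 (r-mono ⊆⊤)

  proper-flat-rank≤2 : ∀ {F} → Flat M F → F ≢ ⊤ → r F ≤ 2
  proper-flat-rank≤2 {F} flatF F≢⊤ = ≤-pred (subst (r F <_) r3 (proper-flat-rank flatF F≢⊤))

  swap-pair : ∀ {F L} → CoveringPair M F L → CoveringPair M L F
  swap-pair {F} {L} (properF , properL , (t , t∈F∩L) , cover) =
    properL , properF , (t , ∈-∩ (∈-∩ʳ t∈F∩L) (∈-∩ˡ t∈F∩L)) , trans (∪-comm L F) cover

  module Pair {F L : Subset n} (pair : CoveringPair M F L) where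
    flatF : Flat M F
    flatF = proj₁ (proj₁ pair)
    F≢⊤ : F ≢ ⊤
    F≢⊤ = proj₂ (proj₁ pair)
    flatL : Flat M L
    flatL = proj₁ (proj₁ (proj₂ pair))
    L≢⊤ : L ≢ ⊤
    L≢⊤ = proj₂ (proj₁ (proj₂ pair))
    t : Fin n
    t = proj₁ (proj₁ (proj₂ (proj₂ pair)))
    t∈F∩L : t ∈ F ∩ L
    t∈F∩L = proj₂ (proj₁ (proj₂ (proj₂ pair)))

    covers : ∀ x → x ∈ F ⊎ x ∈ L
    covers x = x∈p∪q⁻ F L (subst (x ∈_) (sym (proj₂ (proj₂ (proj₂ pair)))) ∈⊤)

    outside-L : ∀ {x} → x ∉ L → x ∈ F
    outside-L {x} x∉L = [ (λ x∈F → x∈F) , (λ x∈L → ⊥-elim (x∉L x∈L)) ]′ (covers x)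

    -- r F = r L = 2 and r (F ∩ L) = 1, from r S + r (F ∩ L) ≤ r F + r L.
    ranks : r F ≡ 2 × r L ≡ 2 × r (F ∩ L) ≡ 1
    ranks = covering-ranks (proper-flat-rank≤2 flatF F≢⊤) (proper-flat-rank≤2 flatL L≢⊤)
              (nonempty-rank t∈F∩L)
              (subst (λ k → k + r (F ∩ L) ≤ r F + r L) r3
                 (≤-trans (+-mono-≤ (r-mono (λ {x} _ → x∈p∪q⁺ (covers x))) ≤-refl) (r-submod F L)))

    rF : r F ≡ 2
    rF = proj₁ ranks
    rL : r L ≡ 2
    rL = proj₁ (proj₂ ranks)
    rF∩L : r (F ∩ L) ≡ 1
    rF∩L = proj₂ (proj₂ ranks)

    -- The part of S outside L has rank 2: otherwise L would be a separator.
    outside-L-rank : 2 ≤ r (⊤ ─ L)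
    outside-L-rank = +-cancelˡ-≤ 2 2 _
      (subst (λ k → 3 < k + r (⊤ ─ L)) rL
        (subst (_< r L + r (⊤ ─ L)) r3 (proper-subset-rank (∈⇒≢⊥ (∈-∩ʳ t∈F∩L)) L≢⊤)))

    -- F is not covered by two sets of rank ≤ 1 one of which meets L: that set
    -- lies in L, so the other would contain S ∖ L, which has rank 2.
    no-small-cover : ∀ {X Y x} → r X ≤ 1 → r Y ≤ 1 → x ∈ X → x ∈ L → ¬ (∀ {y} → y ∈ F → y ∈ X ⊎ y ∈ Y)
    no-small-cover {X} {Y} rX≤1 rY≤1 x∈X x∈L F⊆X∪Y =
      n≮n 1 (≤-trans outside-L-rank (≤-trans (r-mono outside-L⊆Y) rY≤1))
      where
      X⊆L : X ⊆ L
      X⊆L = small-set-in-flat flatL rX≤1 x∈X x∈L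
      outside-L⊆Y : ⊤ ─ L ⊆ Y
      outside-L⊆Y y∈∁L = [ (λ y∈X → ⊥-elim (∉-─ y∈∁L (X⊆L y∈X))) , (λ y∈Y → y∈Y) ]′
                           (F⊆X∪Y (outside-L (∉-─ y∈∁L)))

    -- M|F is inseparable: a proper separator of F splits it into two parts of
    -- rank 1, one of which contains t.
    restriction-inseparable : RestrictionInseparable M F
    restriction-inseparable = no-proper-separator⇒inseparable {E = F} {ρ = r} separator-absurd
      where
      separator-absurd : ∀ A → ¬ ProperSeparator {E = F} {ρ = r} A
      separator-absurd A (A⊆F , sep , (a , a∈A) , (b , b∈F─A)) =
        [ (λ t∈A → no-small-cover rA≤1 rF─A≤1 t∈A t∈L (split F A))
        , (λ t∉A → no-small-cover rF─A≤1 rA≤1 (∈-─ (∈-∩ˡ t∈F∩L) t∉A) t∈L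
                                  (λ y∈F → ⊎-swap (split F A y∈F)))
        ]′ (∈-or-∉ A t)
        where
        t∈L : t ∈ L
        t∈L = ∈-∩ʳ t∈F∩L
        sum≤2 : r A + r (F ─ A) ≤ 2
        sum≤2 = ≤-reflexive (trans sep rF)
        rA≤1 : r A ≤ 1
        rA≤1 = sum≤2⇒≤1 sum≤2 (nonempty-rank b∈F─A)
        rF─A≤1 : r (F ─ A) ≤ 1
        rF─A≤1 = sum≤2⇒≤1 (subst (_≤ 2) (+-comm (r A) _) sum≤2) (nonempty-rank a∈A)

    nondegenerate : NonDegenerate M F
    nondegenerate = ∈⇒≢⊥ (∈-∩ˡ t∈F∩L) , F≢⊤ ,
                    flat-contraction-inseparable flatF (≤-reflexive (trans r3 (cong suc (sym rF)))) ,
                    restriction-inseparable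

    meet-rank≤1 : ∀ {G} → Flat M G → r G ≡ 2 → F ≢ G → r (F ∩ G) ≤ 1
    meet-rank≤1 {G} flatG rG F≢G =
      ≤-pred (subst (r (F ∩ G) <_) rF (distinct-flats-meet flatF flatG (trans rF (sym rG)) F≢G))

    -- If G, H are rank-2 flats covering S, both different from F, then t ∉ G:
    -- otherwise F ∩ G and F ∩ H would be a forbidden small cover of F.
    outside-other-pair : ∀ {G H} → Flat M G → Flat M H → r G ≡ 2 → r H ≡ 2 → F ≢ G → F ≢ H →
                         (∀ x → x ∈ G ⊎ x ∈ H) → t ∉ G
    outside-other-pair flatG flatH rG rH F≢G F≢H covers-GH t∈G =
      no-small-cover (meet-rank≤1 flatG rG F≢G) (meet-rank≤1 flatH rH F≢H)
        (∈-∩ (∈-∩ˡ t∈F∩L) t∈G) (∈-∩ʳ t∈F∩L)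
        (λ {y} y∈F → [ (λ y∈G → inj₁ (∈-∩ y∈F y∈G)) , (λ y∈H → inj₂ (∈-∩ y∈F y∈H)) ]′ (covers-GH y))

    F≢L : F ≢ L
    F≢L F≡L = let (p , p∉L) = ≢⊤⇒outside L≢⊤ in p∉L (subst (p ∈_) F≡L (outside-L p∉L))

  -- The meet of a covering pair is a rank-one degenerate flat: S ∖ L is a
  -- proper separator of M/(F ∩ L), since both it and its complement in
  -- S ∖ (F ∩ L) span, together with F ∩ L, the rank-2 flats F and L.
  meet-degenerate : ∀ {F L} → CoveringPair M F L → RankOneDegenerateFlat M (F ∩ L)
  meet-degenerate {F} {L} pair =
    (flat-∩ flatF flatL , ∈⇒≢⊥ t∈F∩L , ∉⇒≢⊤ (λ p∈F∩L → p∉L (∈-∩ʳ p∈F∩L)) , degenerate) , rF∩L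
    where
    open Pair pair
    module Swapped = Pair (swap-pair pair)
    T A B : Subset n
    T = F ∩ L
    A = ⊤ ─ L
    B = (⊤ ─ T) ─ A
    p q : Fin n
    p = proj₁ (≢⊤⇒outside L≢⊤)
    p∉L : p ∉ L
    p∉L = proj₂ (≢⊤⇒outside L≢⊤)
    q = proj₁ (≢⊤⇒outside F≢⊤)
    q∉F : q ∉ F
    q∉F = proj₂ (≢⊤⇒outside F≢⊤)

    A⊆∁T : A ⊆ ⊤ ─ T
    A⊆∁T x∈A = ∈-compl (λ x∈T → ∉-─ x∈A (∈-∩ʳ x∈T))
    ∁F⊆B : ⊤ ─ F ⊆ B
    ∁F⊆B x∈∁F = ∈-─ (∈-compl (λ x∈T → ∉-─ x∈∁F (∈-∩ˡ x∈T)))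
                    (λ x∈A → ∉-─ x∈∁F (outside-L (∉-─ x∈A)))

    -- S ∖ L ⊆ A ∪ T ⊆ F and S ∖ F ⊆ B ∪ T ⊆ L pin both ranks at 2.
    rA∪T : r (A ∪ T) ≡ 2
    rA∪T = ≤-antisym (≤-trans (r-mono (∪-least (λ x∈A → outside-L (∉-─ x∈A)) ∈-∩ˡ)) (≤-reflexive rF))
                     (≤-trans outside-L-rank (r-mono ∈-∪ˡ))
    rB∪T : r (B ∪ T) ≡ 2
    rB∪T = ≤-antisym (≤-trans (r-mono (∪-least (λ x∈B → ∉-compl⇒∈ (∉-─ x∈B)) ∈-∩ʳ)) (≤-reflexive rL))
                     (≤-trans Swapped.outside-L-rank (r-mono (λ x∈∁F → ∈-∪ˡ (∁F⊆B x∈∁F))))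
    rS : r ((⊤ ─ T) ∪ T) ≡ 3
    rS = ≤-antisym (rank≤3 _)
           (subst (_≤ r ((⊤ ─ T) ∪ T)) r3
             (r-mono (λ {x} _ → [ ∈-∪ʳ , (λ x∉T → ∈-∪ˡ (∈-compl x∉T)) ]′ (∈-or-∉ T x))))

    separates : (r (A ∪ T) ∸ r T) + (r (B ∪ T) ∸ r T) ≡ r ((⊤ ─ T) ∪ T) ∸ r T
    separates = trans (cong₂ _+_ (cong₂ _∸_ rA∪T rF∩L) (cong₂ _∸_ rB∪T rF∩L))
                      (sym (cong₂ _∸_ rS rF∩L))

    -- A is neither empty (p ∈ A) nor all of S ∖ T (q ∈ S ∖ T lies in L).
    degenerate : ¬ NonDegenerate M T
    degenerate (_ , _ , contraction-inseparable , _) =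
      [ ∈⇒≢⊥ (∈-compl p∉L)
      , (λ A≡∁T → ∉-─ (subst (q ∈_) (sym A≡∁T) (∈-compl (λ q∈T → q∉F (∈-∩ˡ q∈T))))
                      (Swapped.outside-L q∉F))
      ]′ (contraction-inseparable A A⊆∁T separates)

  in-every-pair : ∀ {F L G H} → CoveringPair M F L → CoveringPair M G H → F ≡ G ⊎ F ≡ H
  in-every-pair {F} {L} {G} {H} pair pair′ with F ≟ₛ G | F ≟ₛ H
  ... | yes F≡G | _ = inj₁ F≡G
  ... | no _ | yes F≡H = inj₂ F≡H
  ... | no F≢G | no F≢H =
    ⊥-elim ([ outside-other-pair P′.flatF P′.flatL P′.rF P′.rL F≢G F≢H P′.covers
            , outside-other-pair P′.flatL P′.flatF P′.rL P′.rF F≢H F≢G (λ x → ⊎-swap (P′.covers x))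
            ]′ (P′.covers t))
    where
    open Pair pair
    module P′ = Pair pair′

  pair-unique : ∀ {F L F′ L′} → CoveringPair M F L → CoveringPair M F′ L′ →
                (F ≡ F′ × L ≡ L′) ⊎ (F ≡ L′ × L ≡ F′)
  pair-unique pair pair′ with in-every-pair pair pair′ | in-every-pair (swap-pair pair) pair′
  ... | inj₁ F≡F′ | inj₂ L≡L′ = inj₁ (F≡F′ , L≡L′)
  ... | inj₂ F≡L′ | inj₁ L≡F′ = inj₂ (F≡L′ , L≡F′)
  ... | inj₁ F≡F′ | inj₁ L≡F′ = ⊥-elim (Pair.F≢L pair (trans F≡F′ (sym L≡F′)))
  ... | inj₂ F≡L′ | inj₂ L≡L′ = ⊥-elim (Pair.F≢L pair (trans F≡L′ (sym L≡L′)))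

  -- A proper separator A of M/T, for a rank-one flat T, yields the covering
  -- pair A ∪ T, (S ∖ T ∖ A) ∪ T with meet T.
  module FromSeparator {T A : Subset n} (flatT : Flat M T) (T≢⊥ : T ≢ ⊥) (rT : r T ≡ 1)
           (separator : ProperSeparator {E = ⊤ ─ T} {ρ = λ X → r (X ∪ T) ∸ r T} A) where
    B F L : Subset n
    B = (⊤ ─ T) ─ A
    F = A ∪ T
    L = B ∪ T

    A⊆∁T : A ⊆ ⊤ ─ T
    A⊆∁T = proj₁ separator
    a b : Fin n
    a = proj₁ (proj₁ (proj₂ (proj₂ separator)))
    a∈A : a ∈ A
    a∈A = proj₂ (proj₁ (proj₂ (proj₂ separator)))
    b = proj₁ (proj₂ (proj₂ (proj₂ separator)))
    b∈B : b ∈ B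
    b∈B = proj₂ (proj₂ (proj₂ (proj₂ separator)))

    -- Each side of the separator, joined with T, has rank ≥ 2 since T is a
    -- flat; their excesses over r T = 1 sum to r S - 1 = 2.
    side-rank : ∀ {X x} → X ⊆ ⊤ ─ T → x ∈ X → 2 ≤ r (X ∪ T)
    side-rank X⊆∁T x∈X = subst (_< r _) rT
      (flat-extends flatT (∉-─ (X⊆∁T x∈X)) (∪-least ∈-∪ʳ (λ y → ∈-∪ˡ (⁅⁆⊆ x∈X y))))

    ranks : r F ≡ 2 × r L ≡ 2
    ranks = excesses (side-rank A⊆∁T a∈A) (side-rank ∈-─ˡ b∈B)
      (≤-trans (≤-reflexive (subst (λ k → (r F ∸ k) + (r L ∸ k) ≡ r ((⊤ ─ T) ∪ T) ∸ k) rT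
                                   (proj₁ (proj₂ separator))))
               (∸-monoˡ-≤ 1 (rank≤3 _)))

    modular : r F + r L ≤ r ⊤ + r T
    modular = ≤-reflexive (trans (cong₂ _+_ (proj₁ ranks) (proj₂ ranks)) (sym (cong₂ _+_ r3 rT)))

    -- F ∪ L = S, since A and B partition S ∖ T.
    outside-F : ∀ {x} → x ∉ F → x ∈ L
    outside-F x∉F = ∈-∪ˡ (∈-─ (∈-compl (λ x∈T → x∉F (∈-∪ʳ x∈T))) (λ x∈A → x∉F (∈-∪ˡ x∈A)))

    outside-L : ∀ {x} → x ∉ L → x ∈ F
    outside-L {x} x∉L =
      [ ∈-∪ˡ , (λ x∉A → ⊥-elim (x∉L (∈-∪ˡ (∈-─ (∈-compl (λ x∈T → x∉L (∈-∪ʳ x∈T))) x∉A)))) ]′ (∈-or-∉ A x)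

    -- Both sides are flats by modularity; b ∉ F and a ∉ L make them proper.
    pair : CoveringPair M F L
    pair = (modular-cover-flat flatT ∈-∪ʳ ∈-∪ʳ outside-F modular ,
              ∉⇒≢⊤ (λ b∈F → [ ∉-─ b∈B , ∉-─ (∈-─ˡ b∈B) ]′ (x∈p∪q⁻ A T b∈F))) ,
           (modular-cover-flat flatT ∈-∪ʳ ∈-∪ʳ outside-L (subst (_≤ r ⊤ + r T) (+-comm (r F) (r L)) modular) ,
              ∉⇒≢⊤ (λ a∈L → [ (λ a∈B → ∉-─ a∈B a∈A) , ∉-─ (A⊆∁T a∈A) ]′ (x∈p∪q⁻ B T a∈L))) ,
           (t , ∈-∩ (∈-∪ʳ t∈T) (∈-∪ʳ t∈T)) ,
           ⊆-antisym ⊆⊤ (λ {x} _ → x∈p∪q⁺ (covered outside-F x))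
      where
      t : Fin n
      t = proj₁ (≢⊥⇒nonempty T≢⊥)
      t∈T : t ∈ T
      t∈T = proj₂ (≢⊥⇒nonempty T≢⊥)

    meet : F ∩ L ≡ T
    meet = ⊆-antisym in-T (λ x∈T → ∈-∩ (∈-∪ʳ x∈T) (∈-∪ʳ x∈T))
      where
      in-T : F ∩ L ⊆ T
      in-T x∈F∩L with x∈p∪q⁻ A T (∈-∩ˡ x∈F∩L) | x∈p∪q⁻ B T (∈-∩ʳ x∈F∩L)
      ... | inj₂ x∈T | _ = x∈T
      ... | inj₁ _ | inj₂ x∈T = x∈T
      ... | inj₁ x∈A | inj₁ x∈B = ⊥-elim (∉-─ x∈B x∈A)

  -- A rank-one degenerate flat T: M|T has rank 1 and no loops, so it is
  -- inseparable, and degeneracy must come from a proper separator of M/T.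
  module FromDegenerate {T : Subset n} (degenerate : RankOneDegenerateFlat M T) where
    flatT : Flat M T
    flatT = proj₁ (proj₁ degenerate)
    T≢⊥ : T ≢ ⊥
    T≢⊥ = proj₁ (proj₂ (proj₁ degenerate))
    T≢⊤ : T ≢ ⊤
    T≢⊤ = proj₁ (proj₂ (proj₂ (proj₁ degenerate)))
    rT : r T ≡ 1
    rT = proj₂ degenerate

    contraction-separable : ¬ ContractionInseparable M T
    contraction-separable contraction-inseparable =
      proj₂ (proj₂ (proj₂ (proj₁ degenerate)))
        (T≢⊥ , T≢⊤ , contraction-inseparable ,
         rank-one-inseparable (λ _ → nonempty-rank) (≤-reflexive rT))

    open FromSeparator flatT T≢⊥ rT
           (proj₂ (separable⇒proper-separator {E = ⊤ ─ T} {ρ = λ X → r (X ∪ T) ∸ r T} contraction-separable)) public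

  degenerate-is-meet : ∀ {F L T} → CoveringPair M F L → RankOneDegenerateFlat M T → T ≡ F ∩ L
  degenerate-is-meet {F} {L} {T} pair degenerate =
    [ (λ { (F≡ , L≡) → trans (sym D.meet) (sym (cong₂ _∩_ F≡ L≡)) })
    , (λ { (F≡ , L≡) → trans (sym D.meet) (trans (∩-comm D.F D.L) (sym (cong₂ _∩_ F≡ L≡))) })
    ]′ (pair-unique pair D.pair)
    where module D = FromDegenerate degenerate

lemma4p21 : ∀ {n : ℕ} (M : Matroid n) → Inseparable M → Matroid.r M ⊤ ≡ 3 →
      ((∃₂ λ F L → CoveringPair M F L) → ∃ λ T → RankOneDegenerateFlat M T)
    × ((∃ λ T → RankOneDegenerateFlat M T) → ∃₂ λ F L → CoveringPair M F L)
    × (∀ F L F′ L′ → CoveringPair M F L → CoveringPair M F′ L′ →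
         (F ≡ F′ × L ≡ L′) ⊎ (F ≡ L′ × L ≡ F′))
    × (∀ T T′ → RankOneDegenerateFlat M T → RankOneDegenerateFlat M T′ → T ≡ T′)
    × (∀ F L → CoveringPair M F L →
         Matroid.r M F ≡ 2 × Matroid.r M L ≡ 2
         × NonDegenerate M F × NonDegenerate M L)
    × (∀ F L T → CoveringPair M F L → RankOneDegenerateFlat M T → T ≡ F ∩ L)
lemma4p21 M inseparable r3 =
  (λ { (F , L , pair) → F ∩ L , meet-degenerate pair }) ,
  (λ { (T , degenerate) → _ , _ , FromDegenerate.pair degenerate }) ,
  (λ _ _ _ _ → pair-unique) ,
  (λ _ _ degenerate degenerate′ →
     let pair = FromDegenerate.pair degenerate
     in trans (degenerate-is-meet pair degenerate) (sym (degenerate-is-meet pair degenerate′))) ,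
  (λ _ _ pair → Pair.rF pair , Pair.rL pair , Pair.nondegenerate pair ,
                Pair.nondegenerate (swap-pair pair)) ,
  (λ _ _ _ → degenerate-is-meet)
  where open Rank3 M inseparable r3
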